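{- For a positive integer $n$ and a prime $p$ let $F(n,p)=\frac{1}{p^n}\binom{n+p-1}{n}^2-\frac{1}{p^n}\binom{n+p-2}{n}^2$. Then: (1) $F(n+1,p)<F(n,p)$ if either $p>3$ and $n\ge (p+1)/2$, or $p\le 3$ and $n\ge p+1$; (2) for every prime $p>45$, $F((p+1)/2,p)<1$. -}

module Defs where

open import Data.Nat using (ℕ; _+_; _∸_; _^_; NonZero)
open import Data.Nat.Properties using (m^n≢0)
open import Data.Nat.Combinatorics using (_C_)
open import Data.Integer using (ℤ; +_; _-_)
open import Data.Rational using (ℚ; _/_)

-- F(n,p) = (1/p^n) C(n+p-1,n)^2 - (1/p^n) C(n+p-2,n)^2, as a rational number.
-- (Natural subtraction ∸ inside the binomials is exact whenever p ≥ 2,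
--  in particular for primes.)
F : (n p : ℕ) → .{{_ : NonZero p}} → ℚ
F n p = ((+ (((n + p ∸ 1) C n) ^ 2)) - (+ (((n + p ∸ 2) C n) ^ 2))) / (p ^ n)
  where instance _ = m^n≢0 p n

module Submission where

-- Write p = m + 2 and q = p - 1 = m + 1, and let  mset n m = C(n+m, n)  be the
-- number of multisets of size n from m+1 kinds.  The numerator of F(n,p) is
-- the gap  G(n) = a(n)² − b(n)²  with  a(n) = mset n q,  b(n) = mset n m,  so
-- F(n,p) = G(n)/p^n.
--
-- Two binomial recurrences, (n+q)·b(n) = q·a(n) and
-- (n+1)·a(n+1) = (n+q+1)·a(n), give closed forms for the gap:
--   (n+q)²·G(n) = n(n+2q)·a(n)²     and     (n+1)·G(n+1) = (n+1+2q)·a(n)².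
-- Hence G(n+1) < p·G(n) reduces to the polynomial inequality
--   (n+q)²(n+1+2q) < (n+1)(q+1)·n(n+2q),
-- which holds whenever n ≥ 3 and p+1 ≤ 2n (both hypotheses of (1) imply this).
--
-- With n = ⌊(p+1)/2⌋ we have G(n) ≤ a(n)².  For p > 64 the crude
-- bound a(n) ≤ 2^(n+p−1) ≤ 2^(3n) gives a(n)² ≤ 64^n < p^n; the finitely
-- many cases 46 ≤ p ≤ 64 are checked by evaluation.
--
-- Both parts are proved for every p ≥ 2; primality is used only for p ≥ 2.

open import Defs
open import Data.Nat using (ℕ; _+_; _*_; _/_; _≤_; _<_; NonZero)
open import Data.Nat.Primality using (Prime; prime⇒nonZero)
open import Data.Product using (_×_)
open import Data.Sum using (_⊎_)
open import Data.Rational using () renaming (_<_ to _<ℚ_; 1ℚ to one)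

open import Data.Nat as ℕ using (zero; suc; z≤n; s≤s; _∸_; _^_; _%_; z<s; >-nonZero)
open import Data.Nat.Properties
open import Data.Nat.Primality using (prime⇒nonTrivial)
open import Data.Nat.DivMod using (m≡m%n+[m/n]*n; m≥n⇒m/n>0; m%n<n)
open import Data.Nat.Combinatorics using (_C_; nCk+nC[k+1]≡[n+1]C[k+1]; nC1≡n)
open import Data.Nat.Tactic.RingSolver using (solve-∀)
open import Data.Fin using (Fin; toℕ; fromℕ<)
open import Data.Fin.Properties using (all?; toℕ-fromℕ<)
open import Data.Product using (_,_; ∃)
open import Data.Sum using (inj₁; inj₂)
open import Data.Unit using (tt)
open import Data.Integer as ℤ using (ℤ; +_)
import Data.Integer.Properties as ℤP
import Data.Rational as ℚ
open import Data.Rational.Properties using (toℚᵘ-cancel-<; toℚᵘ-fromℚᵘ)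
open import Data.Rational.Unnormalised as ℚᵘ using (mkℚᵘ)
import Data.Rational.Unnormalised.Properties as ℚᵘP
open import Relation.Nullary.Decidable using (toWitness; yes; no)
open import Relation.Binary.PropositionalEquality

/-<-/ : ∀ (i j : ℤ) (d e : ℕ) .{{_ : NonZero d}} .{{_ : NonZero e}} →
        i ℤ.* + e ℤ.< j ℤ.* + d → i ℚ./ d <ℚ j ℚ./ e
/-<-/ i j (suc d) (suc e) i*e<j*d = toℚᵘ-cancel-<
  (ℚᵘP.<-respʳ-≃ (ℚᵘP.≃-sym (toℚᵘ-fromℚᵘ (mkℚᵘ j e)))
  (ℚᵘP.<-respˡ-≃ (ℚᵘP.≃-sym (toℚᵘ-fromℚᵘ (mkℚᵘ i d))) (ℚᵘ.*<* i*e<j*d)))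

/-<-1 : ∀ (i : ℤ) (d : ℕ) .{{_ : NonZero d}} → i ℤ.< + d → i ℚ./ d <ℚ one
/-<-1 i d i<d = /-<-/ i (+ 1) d 1
  (subst₂ ℤ._<_ (sym (ℤP.*-identityʳ i)) (sym (ℤP.*-identityˡ (+ d))) i<d)

pascal : ∀ n k → suc n C suc k ≡ n C k + n C suc k
pascal n k = sym (nCk+nC[k+1]≡[n+1]C[k+1] n k)

C-absorption : ∀ n k → suc k * (suc n C suc k) ≡ suc n * (n C k)
C-absorption zero    zero    = refl
C-absorption zero    (suc k) = *-zeroʳ (suc (suc k))
C-absorption (suc n) zero    =
  trans (+-identityʳ _) (trans (nC1≡n (suc (suc n))) (sym (*-identityʳ _)))
C-absorption (suc n) (suc k) = begin
  suc (suc k) * (suc (suc n) C suc (suc k))  ≡⟨ cong (suc (suc k) *_) (pascal (suc n) (suc k)) ⟩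
  suc (suc k) * (x + y)                      ≡⟨ rearrange k x y ⟩
  suc k * x + x + suc (suc k) * y            ≡⟨ cong₂ (λ u v → u + x + v) (C-absorption n k) (C-absorption n (suc k)) ⟩
  suc n * (n C k) + x + suc n * (n C suc k)  ≡⟨ collect n x (n C k) (n C suc k) ⟩
  suc n * (n C k + n C suc k) + x            ≡⟨ cong (λ u → suc n * u + x) (sym (pascal n k)) ⟩
  suc n * x + x                              ≡⟨ +-comm (suc n * x) x ⟩
  suc (suc n) * x                            ∎
  where
  open ≡-Reasoning
  x = suc n C suc k
  y = suc n C suc (suc k)
  rearrange : ∀ k x y → suc (suc k) * (x + y) ≡ suc k * x + x + suc (suc k) * y
  rearrange = solve-∀
  collect : ∀ n x z w → suc n * z + x + suc n * w ≡ suc n * (z + w) + x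
  collect = solve-∀

C-lower-upper : ∀ k q → suc (k + q) * ((k + q) C suc k) ≡ q * (suc (k + q) C suc k)
C-lower-upper k q = sym (+-cancelˡ-≡ (suc k * c) _ _ (begin
  suc k * c + q * c                        ≡⟨ *-distribʳ-+ c (suc k) q ⟨
  suc N * c                                ≡⟨ cong (suc N *_) (pascal N k) ⟩
  suc N * (N C k + N C suc k)              ≡⟨ *-distribˡ-+ (suc N) (N C k) (N C suc k) ⟩
  suc N * (N C k) + suc N * (N C suc k)    ≡⟨ cong (_+ suc N * (N C suc k)) (C-absorption N k) ⟨
  suc k * c + suc N * (N C suc k)          ∎))
  where
  open ≡-Reasoning
  N = k + q
  c = suc N C suc k

-- C(n,k) ≥ 1 for k ≤ n; needed to divide out the squares a(n)² in part (1).
C-pos : ∀ n k → k ≤ n → 1 ≤ n C k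
C-pos n       zero    _         = ≤-refl
C-pos (suc n) (suc k) (s≤s k≤n) =
  ≤-trans (C-pos n k k≤n) (subst (n C k ≤_) (sym (pascal n k)) (m≤m+n _ _))

-- C(n,k) grows with n; gives b(n) ≤ a(n), so the gap is an honest difference.
C-mono-upper : ∀ n k → n C k ≤ suc n C k
C-mono-upper n zero    = ≤-refl
C-mono-upper n (suc k) = subst (n C suc k ≤_) (sym (pascal n k)) (m≤n+m _ _)

C≤2^ : ∀ n k → n C k ≤ 2 ^ n
C≤2^ n       zero    = ^-monoʳ-≤ 2 {0} {n} z≤n
C≤2^ zero    (suc k) = z≤n
C≤2^ (suc n) (suc k) = subst₂ _≤_ (sym (pascal n k)) (cong (λ u → 2 ^ n + u) (sym (+-identityʳ _)))
  (+-mono-≤ (C≤2^ n k) (C≤2^ n (suc k)))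

mset : ℕ → ℕ → ℕ
mset n m = (n + m) C n

mset-upper : ∀ n m → (n + suc m) * mset n m ≡ suc m * mset n (suc m)
mset-upper zero    m = refl
mset-upper (suc k) m =
  trans (cong (λ x → suc (k + suc m) * (x C suc k)) (sym (+-suc k m))) (C-lower-upper k (suc m))

mset-next : ∀ n m → suc n * mset (suc n) m ≡ (suc n + m) * mset n m
mset-next n m = C-absorption (n + m) n

mset-nonZero : ∀ n m → NonZero (mset n m)
mset-nonZero n m = >-nonZero (C-pos (n + m) n (m≤m+n n m))

mset-mono : ∀ n m → mset n m ≤ mset n (suc m)
mset-mono n m = subst (λ x → mset n m ≤ x C n) (sym (+-suc n m)) (C-mono-upper (n + m) n)

mset-square-bound : ∀ n m → m ≤ 2 * n → mset n m * mset n m ≤ 64 ^ n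
mset-square-bound n m m≤2n = begin
  mset n m * mset n m          ≤⟨ *-mono-≤ a≤2^3n a≤2^3n ⟩
  2 ^ (3 * n) * 2 ^ (3 * n)    ≡⟨ ^-distribˡ-+-* 2 (3 * n) (3 * n) ⟨
  2 ^ (3 * n + 3 * n)          ≡⟨ cong (2 ^_) (double n) ⟩
  2 ^ (6 * n)                  ≡⟨ ^-*-assoc 2 6 n ⟨
  64 ^ n                       ∎
  where
  open ≤-Reasoning
  double : ∀ n → 3 * n + 3 * n ≡ 6 * n
  double = solve-∀
  triple : ∀ n → n + 2 * n ≡ 3 * n
  triple = solve-∀
  n+m≤3n : n + m ≤ 3 * n
  n+m≤3n = subst (n + m ≤_) (triple n) (+-monoʳ-≤ n m≤2n)
  a≤2^3n : mset n m ≤ 2 ^ (3 * n)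
  a≤2^3n = ≤-trans (C≤2^ (n + m) n) (^-monoʳ-≤ 2 n+m≤3n)

gap : ℕ → ℕ → ℕ
gap n m = mset n (suc m) * mset n (suc m) ∸ mset n m * mset n m

scaled-square-gap : ∀ n q a b → (n + q) * b ≡ q * a →
                    (n + q) * (n + q) * (a * a ∸ b * b) ≡ n * (n + q + q) * (a * a)
scaled-square-gap n q a b N*b≡q*a = begin
  N * N * (a * a ∸ b * b)                               ≡⟨ *-distribˡ-∸ (N * N) (a * a) (b * b) ⟩
  N * N * (a * a) ∸ N * N * (b * b)                     ≡⟨ cong₂ _∸_ (split n q (a * a)) N²b²≡q²a² ⟩
  n * (n + q + q) * (a * a) + q * q * (a * a) ∸ q * q * (a * a) ≡⟨ m+n∸n≡m _ (q * q * (a * a)) ⟩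
  n * (n + q + q) * (a * a)                             ∎
  where
  open ≡-Reasoning
  N = n + q
  split : ∀ n q x → (n + q) * (n + q) * x ≡ n * (n + q + q) * x + q * q * x
  split = solve-∀
  N²b²≡q²a² : N * N * (b * b) ≡ q * q * (a * a)
  N²b²≡q²a² = begin
    N * N * (b * b)   ≡⟨ [m*n]*[o*p]≡[m*o]*[n*p] N N b b ⟩
    N * b * (N * b)   ≡⟨ cong (λ t → t * t) N*b≡q*a ⟩
    q * a * (q * a)   ≡⟨ [m*n]*[o*p]≡[m*o]*[n*p] q a q a ⟩
    q * q * (a * a)   ∎

gap-closed : ∀ n m → (n + suc m) * (n + suc m) * gap n m
                     ≡ n * (n + suc m + suc m) * (mset n (suc m) * mset n (suc m))
gap-closed n m = scaled-square-gap n (suc m) (mset n (suc m)) (mset n m) (mset-upper n m)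

gap-next : ∀ n m → suc n * gap (suc n) m
                   ≡ (suc n + suc m + suc m) * (mset n (suc m) * mset n (suc m))
gap-next n m = *-cancelˡ-≡ _ _ (N * N) (begin
  N * N * (suc n * G)              ≡⟨ swap (N * N) (suc n) G ⟩
  suc n * (N * N * G)              ≡⟨ cong (suc n *_) (gap-closed (suc n) m) ⟩
  suc n * (suc n * S * (a′ * a′))  ≡⟨ regroup (suc n) S a′ ⟩
  S * (suc n * a′ * (suc n * a′))  ≡⟨ cong (λ t → S * (t * t)) (mset-next n (suc m)) ⟩
  S * (N * a * (N * a))            ≡⟨ ungroup S N a ⟩
  N * N * (S * (a * a))            ∎)
  where
  open ≡-Reasoning
  q = suc m
  N = suc n + q
  S = suc n + q + q
  a = mset n q
  a′ = mset (suc n) q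
  G = gap (suc n) m
  swap : ∀ x y z → x * (y * z) ≡ y * (x * z)
  swap = solve-∀
  regroup : ∀ s S x → s * (s * S * (x * x)) ≡ S * (s * x * (s * x))
  regroup = solve-∀
  ungroup : ∀ S N x → S * (N * x * (N * x)) ≡ N * N * (S * (x * x))
  ungroup = solve-∀

-- Part (1): the gap decreases relative to p^n

-- The correction term in  (n+1)(q+1)·n(n+2q) − (n+q)²(n+1+2q) = q·excess,
-- for n = k+3 and 2n = q+2+r; every summand is visibly non-negative.
excess : ℕ → ℕ → ℕ → ℕ
excess k q r = (3 + k) * (3 + k) * (2 + k) + q * (5 + 2 * k) * k + 2 * q * r

-- The margin identity; the relation 2n = q+2+r is what removes the negative terms.
ratio-margin : ∀ k q r → suc q + 1 + r ≡ 2 * (3 + k) →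
               (4 + k) * suc q * ((3 + k) * (3 + k + q + q))
               ≡ (3 + k + q) * (3 + k + q) * (4 + k + q + q) + q * excess k q r
ratio-margin k q r 2n≡q+2+r = +-cancelʳ-≡ (2 * q * q * (2 * (3 + k))) _ _ (begin
  rhs + 2 * q * q * (2 * (3 + k))             ≡⟨ cong (λ t → rhs + 2 * q * q * t) (sym 2n≡q+2+r) ⟩
  rhs + 2 * q * q * (suc q + 1 + r)           ≡⟨ identity k q r ⟩
  lhs + q * excess k q r + 2 * q * q * (2 * (3 + k)) ∎)
  where
  open ≡-Reasoning
  lhs = (3 + k + q) * (3 + k + q) * (4 + k + q + q)
  rhs = (4 + k) * suc q * ((3 + k) * (3 + k + q + q))
  identity : ∀ k q r →
    (4 + k) * suc q * ((3 + k) * (3 + k + q + q)) + 2 * q * q * (suc q + 1 + r)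
    ≡ (3 + k + q) * (3 + k + q) * (4 + k + q + q)
      + q * ((3 + k) * (3 + k) * (2 + k) + q * (5 + 2 * k) * k + 2 * q * r)
      + 2 * q * q * (2 * (3 + k))
  identity = solve-∀

ratio-inequality : ∀ n q → 3 ≤ n → 1 ≤ q → suc q + 1 ≤ 2 * n →
                   (n + q) * (n + q) * (suc n + q + q) < suc n * suc q * (n * (n + q + q))
ratio-inequality n (suc q) 3≤n _ bound with m≤n⇒∃[o]m+o≡n 3≤n
... | k , refl with m≤n⇒∃[o]m+o≡n bound
... | r , 2n≡q+2+r =
  subst (lhs <_) (sym (ratio-margin k (suc q) r 2n≡q+2+r)) (m<m+n lhs z<s)
  where lhs = (3 + k + suc q) * (3 + k + suc q) * (4 + k + suc q + suc q)

gap-decreasing : ∀ n m → 3 ≤ n → 2 + m + 1 ≤ 2 * n → gap (suc n) m < (2 + m) * gap n m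
gap-decreasing n m 3≤n bound = *-cancelˡ-< (suc n * (N * N)) _ _ (begin-strict
  suc n * (N * N) * gap (suc n) m          ≡⟨ swap (suc n) (N * N) (gap (suc n) m) ⟩
  N * N * (suc n * gap (suc n) m)          ≡⟨ cong (N * N *_) (gap-next n m) ⟩
  N * N * (S * (a * a))                    ≡⟨ *-assoc (N * N) S (a * a) ⟨
  N * N * S * (a * a)                      <⟨ *-monoˡ-< (a * a) {{m*n≢0 a a}} (ratio-inequality n q 3≤n (s≤s z≤n) bound) ⟩
  suc n * suc q * V * (a * a)              ≡⟨ *-assoc (suc n * suc q) V (a * a) ⟩
  suc n * suc q * (V * (a * a))            ≡⟨ cong (suc n * suc q *_) (gap-closed n m) ⟨
  suc n * suc q * (N * N * gap n m)        ≡⟨ exchange (suc n) (suc q) (N * N) (gap n m) ⟩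
  suc n * (N * N) * (suc q * gap n m)      ∎)
  where
  open ≤-Reasoning
  q = suc m
  N = n + q
  S = suc n + q + q
  V = n * (n + q + q)
  a = mset n q
  instance a≢0 = mset-nonZero n q
  swap : ∀ x y z → x * y * z ≡ y * (x * z)
  swap = solve-∀
  exchange : ∀ x y z w → x * y * (z * w) ≡ x * z * (y * w)
  exchange = solve-∀

F≡gap/p^n : ∀ n m → F n (2 + m) ≡ ((+ gap n m) ℚ./ ((2 + m) ^ n)) {{m^n≢0 (2 + m) n}}
F≡gap/p^n n m = cong (λ i → (i ℚ./ (p ^ n)) {{m^n≢0 p n}}) numerator
  where
  open ≡-Reasoning
  p = 2 + m
  a = mset n (suc m)
  b = mset n m
  square : ∀ x → x ^ 2 ≡ x * x
  square x = cong (x *_) (*-identityʳ x)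
  upper : ((n + p ∸ 1) C n) ^ 2 ≡ a * a
  upper = trans (cong (λ x → ((x ∸ 1) C n) ^ 2) (+-suc n (suc m))) (square a)
  lower : ((n + p ∸ 2) C n) ^ 2 ≡ b * b
  lower = trans (cong (λ x → ((x ∸ 2) C n) ^ 2) (trans (+-suc n (suc m)) (cong suc (+-suc n m))))
                (square b)
  numerator : + (((n + p ∸ 1) C n) ^ 2) ℤ.- + (((n + p ∸ 2) C n) ^ 2) ≡ + gap n m
  numerator = begin
    + (((n + p ∸ 1) C n) ^ 2) ℤ.- + (((n + p ∸ 2) C n) ^ 2) ≡⟨ cong₂ (λ x y → + x ℤ.- + y) upper lower ⟩
    + (a * a) ℤ.- + (b * b)                                ≡⟨ ℤP.m-n≡m⊖n (a * a) (b * b) ⟩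
    (a * a) ℤ.⊖ (b * b)                                    ≡⟨ ℤP.⊖-≥ (*-mono-≤ (mset-mono n m) (mset-mono n m)) ⟩
    + gap n m                                              ∎

F-decreasing : ∀ n m → 3 ≤ n → 2 + m + 1 ≤ 2 * n → F (suc n) (2 + m) <ℚ F n (2 + m)
F-decreasing n m 3≤n bound = subst₂ _<ℚ_ (sym (F≡gap/p^n (suc n) m)) (sym (F≡gap/p^n n m))
  (/-<-/ (+ gap (suc n) m) (+ gap n m) (p ^ suc n) (p ^ n) {{m^n≢0 p (suc n)}}
    (subst₂ ℤ._<_ (ℤP.pos-* (gap (suc n) m) (p ^ n)) (ℤP.pos-* (gap n m) (p ^ suc n)) (ℤ.+<+ cross)))
  where
  open ≤-Reasoning
  p = 2 + m
  instance p^n≢0 = m^n≢0 p n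
  reorder : ∀ x y z → x * y * z ≡ y * (x * z)
  reorder = solve-∀
  cross : gap (suc n) m * p ^ n < gap n m * p ^ suc n
  cross = begin-strict
    gap (suc n) m * p ^ n        <⟨ *-monoˡ-< (p ^ n) (gap-decreasing n m 3≤n bound) ⟩
    p * gap n m * p ^ n          ≡⟨ reorder p (gap n m) (p ^ n) ⟩
    gap n m * p ^ suc n          ∎

-- Part (2): the central term

central : ℕ → ℕ
central p = (p + 1) / 2

p≤2*central : ∀ p → p ≤ 2 * central p
p≤2*central p = subst (p ≤_) (*-comm (central p) 2) (≤-pred (begin
  suc p                                ≡⟨ +-comm 1 p ⟩
  p + 1                                ≡⟨ m≡m%n+[m/n]*n (p + 1) 2 ⟩
  (p + 1) % 2 + central p * 2          ≤⟨ +-monoˡ-≤ (central p * 2) (≤-pred (m%n<n (p + 1) 2)) ⟩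
  suc (central p * 2)                  ∎))
  where open ≤-Reasoning

CentralBound : ℕ → Set
CentralBound m = mset (central (2 + m)) (suc m) * mset (central (2 + m)) (suc m)
                 < (2 + m) ^ central (2 + m)

-- For 46 ≤ p ≤ 64, i.e. m = 44 + i with i < 19, the bound is checked by evaluation.
central-bound-small : ∀ (i : Fin 19) → CentralBound (44 + toℕ i)
central-bound-small = toWitness {a? = all? (λ i → _ <? _)} tt

central-bound-large : ∀ m → 62 < m → CentralBound m
central-bound-large m 62<m = begin-strict
  mset n (suc m) * mset n (suc m)    ≤⟨ mset-square-bound n (suc m) (≤-trans (n≤1+n (suc m)) (p≤2*central (2 + m))) ⟩
  64 ^ n                             <⟨ ^-monoˡ-< n {{n≢0}} (s≤s (s≤s 62<m)) ⟩
  (2 + m) ^ n                        ∎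
  where
  open ≤-Reasoning
  n = central (2 + m)
  n≢0 : NonZero n
  n≢0 = >-nonZero (m≥n⇒m/n>0 {2 + m + 1} {2} (s≤s (s≤s z≤n)))

central-bound : ∀ t → CentralBound (44 + t)
central-bound t with t ≤? 18
... | yes t≤18 = subst (λ s → CentralBound (44 + s)) (toℕ-fromℕ< (s≤s t≤18))
                   (central-bound-small (fromℕ< (s≤s t≤18)))
... | no t≰18  = central-bound-large (44 + t) (+-monoʳ-< 44 (≰⇒> t≰18))

F-central-below-one : ∀ t → F (central (46 + t)) (46 + t) <ℚ one
F-central-below-one t = subst (_<ℚ one) (sym (F≡gap/p^n n m))
  (/-<-1 (+ gap n m) ((2 + m) ^ n) {{m^n≢0 (2 + m) n}}
    (ℤ.+<+ (≤-<-trans (m∸n≤m _ (mset n m * mset n m)) (central-bound t))))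
  where
  m = 44 + t
  n = central (2 + m)

F-central<1 : ∀ p .{{_ : NonZero p}} → 45 < p → F (central p) p <ℚ one
F-central<1 p 45<p = at-offset (m≤n⇒∃[o]m+o≡n 45<p)
  where
  at-offset : ∃ (λ t → 46 + t ≡ p) → F (central p) p <ℚ one
  at-offset (t , refl) = F-central-below-one t

part1-range : ∀ n p → 2 ≤ p → ((3 < p × p + 1 ≤ 2 * n) ⊎ (p ≤ 3 × p + 1 ≤ n)) →
              3 ≤ n × p + 1 ≤ 2 * n
part1-range n p _   (inj₁ (3<p , p+1≤2n)) =
  5≤2n⇒3≤n n (≤-trans (s≤s 3<p) (subst (_≤ 2 * n) (+-comm p 1) p+1≤2n)) , p+1≤2n
  where
  5≤2n⇒3≤n : ∀ n → 5 ≤ 2 * n → 3 ≤ n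
  5≤2n⇒3≤n 0 ()
  5≤2n⇒3≤n 1 (s≤s (s≤s ()))
  5≤2n⇒3≤n 2 (s≤s (s≤s (s≤s (s≤s ()))))
  5≤2n⇒3≤n (suc (suc (suc n))) _ = s≤s (s≤s (s≤s z≤n))
part1-range n p 2≤p (inj₂ (_ , p+1≤n)) =
  ≤-trans (s≤s 2≤p) (subst (_≤ n) (+-comm p 1) p+1≤n) , ≤-trans p+1≤n (m≤m+n n (n + 0))

F-decreasing-range : ∀ n p .{{_ : NonZero p}} → 2 ≤ p →
                     ((3 < p × p + 1 ≤ 2 * n) ⊎ (p ≤ 3 × p + 1 ≤ n)) → F (n + 1) p <ℚ F n p
F-decreasing-range n p 2≤p hyp = at-offset (m≤n⇒∃[o]m+o≡n 2≤p) (part1-range n p 2≤p hyp)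
  where
  at-offset : ∃ (λ m → 2 + m ≡ p) → 3 ≤ n × p + 1 ≤ 2 * n → F (n + 1) p <ℚ F n p
  at-offset (m , refl) (3≤n , p+1≤2n) =
    subst (λ k → F k (2 + m) <ℚ F n (2 + m)) (+-comm 1 n) (F-decreasing n m 3≤n p+1≤2n)

prime≥2 : ∀ {p} → Prime p → 2 ≤ p
prime≥2 {p} pr = ℕ.nonTrivial⇒n>1 p {{prime⇒nonTrivial pr}}

lemma2p5 : ((n p : ℕ) → (pr : Prime p) → 1 ≤ n →
    ((3 < p × p + 1 ≤ 2 * n) ⊎ (p ≤ 3 × p + 1 ≤ n)) →
    _<ℚ_ (F (n + 1) p {{prime⇒nonZero pr}}) (F n p {{prime⇒nonZero pr}}))
    × ((p : ℕ) → (pr : Prime p) → 45 < p →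
    _<ℚ_ (F ((p + 1) / 2) p {{prime⇒nonZero pr}}) one)
lemma2p5 =
  (λ n p pr _ → F-decreasing-range n p {{prime⇒nonZero pr}} (prime≥2 pr)) ,
  (λ p pr → F-central<1 p {{prime⇒nonZero pr}})
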